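{- Let $\mathcal M$ be a multiset of $k$ perfect matchings of the Petersen graph $P$ and let $\mu = \mu(P^{\mathcal M})$. Then $\lambda(P^{\mathcal M}) = \min\{k+3,\ 2k+6-2\mu\}$.
   Context: Graphs may have parallel edges but no loops. For vertices $u,v$ of a graph $G$, $\mu_G(u,v)$ is the number of edges joining $u$ and $v$, and $\mu(G) = \max_{u,v} \mu_G(u,v)$. The edge-connectivity $\lambda(G)$ is the maximum $k$ such that $|\partial_G(X)| \geq k$ for every non-empty proper subset $X \subset V(G)$, where $\partial_G(X)$ is the set of edges with exactly one end in $X$. $P$ is the Petersen graph. For a multiset $\mathcal M$ of perfect matchings of $P$, $P^{\mathcal M}$ is the graph obtained from $P$ by adding, for each $F \in \mathcal M$ (with multiplicity), a new parallel copy of every edge of $F$. -}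

module Defs where

open import Data.Nat using (ℕ; zero; suc; _+_; _*_; _≤_)
open import Data.Bool using (Bool; true; false; if_then_else_; not; _∧_; _∨_)
open import Data.Fin using (Fin; #_)
open import Data.Fin.Properties using (_≟_)
open import Data.Fin.Subset using (Subset; _∈_; _∉_; Nonempty)
open import Data.Vec using (Vec; lookup; _∷_; [])
open import Data.List using (List; map; allFin)
open import Data.Nat.ListAction using (sum)
open import Data.Product using (_×_; _,_; proj₁; proj₂; ∃; ∃-syntax)
open import Relation.Nullary using (¬_)
open import Relation.Nullary.Decidable using (⌊_⌋)
open import Relation.Binary.PropositionalEquality using (_≡_)

Σ[_]_ : (n : ℕ) → (Fin n → ℕ) → ℕ
Σ[ n ] f = sum (map f (allFin n))

[_] : Bool → ℕ
[ true ] = 1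
[ false ] = 0

-- (Represented by its multiplicity function; the graphs we build are
-- symmetric and loopless by construction.)
MultiGraph : ℕ → Set
MultiGraph n = Fin n → Fin n → ℕ

-- |∂_G(X)| : number of edges with exactly one end in X
-- (each such edge is counted once: its end u in X, its end v outside X).
cutSize : ∀ {n} → MultiGraph n → Subset n → ℕ
cutSize {n} G X =
  Σ[ n ] λ u → Σ[ n ] λ v →
    [ lookup X u ∧ not (lookup X v) ] * G u v

NonEmptyProper : ∀ {n} → Subset n → Set
NonEmptyProper {n} X = Nonempty X × (∃[ v ] v ∉ X)

IsEdgeConnectivity : ∀ {n} → MultiGraph n → ℕ → Set
IsEdgeConnectivity {n} G l =
  (∀ (X : Subset n) → NonEmptyProper X → l ≤ cutSize G X)
  × (∀ (k : ℕ) → (∀ (X : Subset n) → NonEmptyProper X → k ≤ cutSize G X) → k ≤ l)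

IsMaxMultiplicity : ∀ {n} → MultiGraph n → ℕ → Set
IsMaxMultiplicity {n} G m =
  (∃[ u ] ∃[ v ] G u v ≡ m) × (∀ u v → G u v ≤ m)

-- The Petersen graph: outer cycle 0-1-2-3-4, spokes i-(i+5),
-- inner pentagram 5-7-9-6-8.

PetersenEdges : Vec (Fin 10 × Fin 10) 15
PetersenEdges =
  (# 0 , # 1) ∷ (# 1 , # 2) ∷ (# 2 , # 3) ∷ (# 3 , # 4) ∷ (# 4 , # 0) ∷
  (# 0 , # 5) ∷ (# 1 , # 6) ∷ (# 2 , # 7) ∷ (# 3 , # 8) ∷ (# 4 , # 9) ∷
  (# 5 , # 7) ∷ (# 7 , # 9) ∷ (# 9 , # 6) ∷ (# 6 , # 8) ∷ (# 8 , # 5) ∷ []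

incident : Fin 15 → Fin 10 → Bool
incident e v = ⌊ proj₁ (lookup PetersenEdges e) ≟ v ⌋ ∨ ⌊ proj₂ (lookup PetersenEdges e) ≟ v ⌋

joins : Fin 15 → Fin 10 → Fin 10 → Bool
joins e u v =
  (⌊ proj₁ (lookup PetersenEdges e) ≟ u ⌋ ∧ ⌊ proj₂ (lookup PetersenEdges e) ≟ v ⌋)
  ∨ (⌊ proj₁ (lookup PetersenEdges e) ≟ v ⌋ ∧ ⌊ proj₂ (lookup PetersenEdges e) ≟ u ⌋)

IsPerfectMatching : (Fin 15 → Bool) → Set
IsPerfectMatching F = ∀ (v : Fin 10) → Σ[ 15 ] (λ e → [ F e ∧ incident e v ]) ≡ 1

record PerfectMatching : Set where
  field
    edges   : Fin 15 → Bool
    perfect : IsPerfectMatching edges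
open PerfectMatching public

PMmult : ∀ {k} → (Fin k → PerfectMatching) → Fin 10 → Fin 10 → ℕ
PMmult {k} M u v =
  Σ[ 15 ] λ e → [ joins e u v ] * (1 + Σ[ k ] (λ i → [ edges (M i) e ]))

P^ : ∀ {k} → (Fin k → PerfectMatching) → MultiGraph 10
P^ M = PMmult M

-- The cut of P^M along X consists of the edges of P crossing X together with, for every
-- matching M i, the edges of M i crossing X.  P has exactly six perfect matchings, and a
-- check of all subsets shows that every non-empty proper X either is crossed by at least 3
-- edges of P and by every perfect matching, so that its cut in P^M has size at least k + 3,
-- or has an edge e such that X is crossed by at least 4 edges of P and by every perfect
-- matching F at least 2 − 2[e ∈ F] times, so that its cut has size at least
-- 2k + 6 − 2μ(e) ≥ 2k + 6 − 2μ.  Both bounds are attained: by a single vertex, and by the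
-- two ends of an edge of multiplicity μ.

module Submission where

open import Defs
open import Data.Bool using (Bool; true; false; T; _∧_; not; _xor_)
import Data.Bool.Properties as Bool
open import Data.Bool.Properties using (T-∧)
open import Data.Fin using (Fin; zero; suc)
open import Data.Fin.Properties using (_≟_; all?; any?)
open import Data.Fin.Subset using (Subset; ⁅_⁆; _∪_)
open import Data.Fin.Subset.Properties using (nonempty?; _∈?_)
import Data.List as List using (tabulate)
open import Data.List.Properties using (map-tabulate)
import Data.Nat.ListAction as List using (sum)
open import Data.Nat using (ℕ; zero; suc; _+_; _*_; _∸_; _⊓_; _≤_; _≤?_)
open import Data.Nat.Properties
  using (≤-refl; ≤-trans; +-mono-≤; *-monoʳ-≤; *-identityˡ; *-identityʳ; *-comm; *-assoc; *-distribˡ-+;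
         +-identityʳ; +-comm; +-monoʳ-≤; m≤m+n; m≤n+o⇒m∸n≤o; m+n∸n≡m; m⊓n≤m; m⊓n≤n; ⊓-glb; module ≤-Reasoning)
import Data.Nat.Properties as ℕ
open import Algebra.Properties.Semiring.Sum ℕ.+-*-semiring
  using (sum; sum-cong-≗; sum-replicate-zero; ∑-distrib-+; ∑-comm; *-distribˡ-sum; *-distribʳ-sum)
open import Data.Nat.Solver using (module +-*-Solver)
open import Data.Product using (_×_; _,_; proj₁; proj₂; ∃; map₂)
open import Data.Sum using (_⊎_; inj₁; inj₂)
open import Data.Vec using ([]; _∷_; lookup; tabulate)
open import Data.Vec.Properties using (lookup∘tabulate; ≡-dec)
open import Function using (_∘_; id; Equivalence)
open Equivalence using (to)
open import Relation.Binary.PropositionalEquality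
  using (_≡_; _≗_; refl; sym; trans; cong; cong₂; subst; module ≡-Reasoning)
open import Relation.Nullary using (yes; no; ¬?)
open import Relation.Nullary.Decidable using (⌊_⌋; isYes; toWitness; from-yes; _×-dec_; _⊎-dec_; _→-dec_)
open import Relation.Unary using (Pred; Decidable)

open +-*-Solver using (solve; _:+_; _:*_; _:=_; con)

-- Finite sums

Σ≡sum : ∀ n (f : Fin n → ℕ) → Σ[ n ] f ≡ sum f
Σ≡sum n f = trans (cong List.sum (map-tabulate id f)) (tabulate-sum n f)
  where
  tabulate-sum : ∀ n (f : Fin n → ℕ) → List.sum (List.tabulate f) ≡ sum f
  tabulate-sum zero    f = refl
  tabulate-sum (suc n) f = cong (f zero +_) (tabulate-sum n (λ j → f (suc j)))

sum-mono-≤ : ∀ {n} {f g : Fin n → ℕ} → (∀ i → f i ≤ g i) → sum f ≤ sum g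
sum-mono-≤ {zero}  f≤g = ≤-refl
sum-mono-≤ {suc n} f≤g = +-mono-≤ (f≤g zero) (sum-mono-≤ (λ i → f≤g (suc i)))

sum-const : ∀ n c → sum {n} (λ _ → c) ≡ n * c
sum-const zero    c = refl
sum-const (suc n) c = cong (c +_) (sum-const n c)

sum-δ : ∀ {n} (i : Fin n) (f : Fin n → ℕ) → sum (λ j → [ ⌊ i ≟ j ⌋ ] * f j) ≡ f i
sum-δ {suc n} zero    f = trans (cong (f zero + 0 +_) (sum-replicate-zero n)) (trans (+-identityʳ _) (+-identityʳ _))
sum-δ {suc n} (suc i) f =
  trans (sum-cong-≗ (λ j → cong (λ b → [ b ] * f (suc j)) (⌊suc≟suc⌋ i j))) (sum-δ i (λ j → f (suc j)))
  where
  -- ⌊_⌋ is isYes, which does not compute through the map′ in the definition of _≟_.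
  ⌊suc≟suc⌋ : ∀ {n} (i j : Fin n) → ⌊ suc i ≟ suc j ⌋ ≡ ⌊ i ≟ j ⌋
  ⌊suc≟suc⌋ i j with i ≟ j
  ... | yes _ = refl
  ... | no  _ = refl

[∧]*≡[]*[]* : ∀ x y c → [ x ∧ y ] * c ≡ [ x ] * ([ y ] * c)
[∧]*≡[]*[]* true  y c = sym (*-identityˡ _)
[∧]*≡[]*[]* false y c = refl

[]*[]≡[∧] : ∀ x y → [ x ] * [ y ] ≡ [ y ∧ x ]
[]*[]≡[∧] true  true  = refl
[]*[]≡[∧] true  false = refl
[]*[]≡[∧] false y     = sym (cong [_] (Bool.∧-zeroʳ y))

[∧not]+[∧not]≡[xor] : ∀ x y → [ x ∧ not y ] + [ y ∧ not x ] ≡ [ x xor y ]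
[∧not]+[∧not]≡[xor] true  true  = refl
[∧not]+[∧not]≡[xor] true  false = refl
[∧not]+[∧not]≡[xor] false true  = refl
[∧not]+[∧not]≡[xor] false false = refl

sum-δ₂ : ∀ {m n} (i : Fin m) (j : Fin n) (f : Fin m → Fin n → ℕ) →
  sum (λ u → sum (λ v → [ ⌊ i ≟ u ⌋ ∧ ⌊ j ≟ v ⌋ ] * f u v)) ≡ f i j
sum-δ₂ i j f = begin
  sum (λ u → sum (λ v → [ ⌊ i ≟ u ⌋ ∧ ⌊ j ≟ v ⌋ ] * f u v))
    ≡⟨ sum-cong-≗ (λ u → trans (sum-cong-≗ (λ v → [∧]*≡[]*[]* ⌊ i ≟ u ⌋ ⌊ j ≟ v ⌋ (f u v)))
                               (sym (*-distribˡ-sum [ ⌊ i ≟ u ⌋ ] (λ v → [ ⌊ j ≟ v ⌋ ] * f u v)))) ⟩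
  sum (λ u → [ ⌊ i ≟ u ⌋ ] * sum (λ v → [ ⌊ j ≟ v ⌋ ] * f u v))
    ≡⟨ sum-δ i (λ u → sum (λ v → [ ⌊ j ≟ v ⌋ ] * f u v)) ⟩
  sum (λ v → [ ⌊ j ≟ v ⌋ ] * f i v)
    ≡⟨ sum-δ j (f i) ⟩
  f i j ∎
  where open ≡-Reasoning

-- Exhaustive search over subsets

-- Enumerating with booleans, rather than composing Dec values, avoids retaining the
-- evidence for each of the up to 2^15 cases.
allSubsets : ∀ {n} → (Subset n → Bool) → Bool
allSubsets {zero}  p = p []
allSubsets {suc n} p = allSubsets (λ S → p (true ∷ S)) ∧ allSubsets (λ S → p (false ∷ S))

allSubsets-sound : ∀ {n} (p : Subset n → Bool) → T (allSubsets p) → ∀ S → T (p S)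
allSubsets-sound {zero}  p t []          = t
allSubsets-sound {suc n} p t (true ∷ S)  = allSubsets-sound (λ S → p (true ∷ S)) (proj₁ (to T-∧ t)) S
allSubsets-sound {suc n} p t (false ∷ S) = allSubsets-sound (λ S → p (false ∷ S)) (proj₂ (to T-∧ t)) S

∀-Subset : ∀ {n p} {P : Pred (Subset n) p} (P? : Decidable P) → T (allSubsets (isYes ∘ P?)) → ∀ S → P S
∀-Subset P? t S = toWitness (allSubsets-sound (isYes ∘ P?) t S)

nonEmptyProper? : ∀ {n} → Decidable (NonEmptyProper {n})
nonEmptyProper? X = nonempty? X ×-dec any? (λ v → ¬? (v ∈? X))

-- Cuts of multigraphs

separates : ∀ {n} → Subset n → Fin n → Fin n → ℕ
separates X u v = [ lookup X u ∧ not (lookup X v) ]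

cutSize≡sum : ∀ {n} (G : MultiGraph n) X →
  cutSize G X ≡ sum (λ u → sum (λ v → separates X u v * G u v))
cutSize≡sum {n} G X = trans (Σ≡sum n _) (sum-cong-≗ {n} (λ u → Σ≡sum n _))

cutSize-cong : ∀ {n} {G H : MultiGraph n} → (∀ u v → G u v ≡ H u v) → ∀ X → cutSize G X ≡ cutSize H X
cutSize-cong {G = G} {H} G≡H X = begin
  cutSize G X ≡⟨ cutSize≡sum G X ⟩
  sum (λ u → sum (λ v → separates X u v * G u v))
    ≡⟨ sum-cong-≗ (λ u → sum-cong-≗ (λ v → cong (separates X u v *_) (G≡H u v))) ⟩
  sum (λ u → sum (λ v → separates X u v * H u v))
    ≡⟨ cutSize≡sum H X ⟨
  cutSize H X ∎
  where open ≡-Reasoning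

cutSize-sum : ∀ {m n} (G : Fin m → MultiGraph n) X →
  cutSize (λ u v → sum (λ e → G e u v)) X ≡ sum (λ e → cutSize (G e) X)
cutSize-sum G X = begin
  cutSize (λ u v → sum (λ e → G e u v)) X
    ≡⟨ cutSize≡sum (λ u v → sum (λ e → G e u v)) X ⟩
  sum (λ u → sum (λ v → separates X u v * sum (λ e → G e u v)))
    ≡⟨ sum-cong-≗ (λ u → sum-cong-≗ (λ v → *-distribˡ-sum (separates X u v) (λ e → G e u v))) ⟩
  sum (λ u → sum (λ v → sum (λ e → separates X u v * G e u v)))
    ≡⟨ sum-cong-≗ (λ u → ∑-comm (λ v e → separates X u v * G e u v)) ⟩
  sum (λ u → sum (λ e → sum (λ v → separates X u v * G e u v)))
    ≡⟨ ∑-comm (λ u e → sum (λ v → separates X u v * G e u v)) ⟩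
  sum (λ e → sum (λ u → sum (λ v → separates X u v * G e u v)))
    ≡⟨ sum-cong-≗ (λ e → cutSize≡sum (G e) X) ⟨
  sum (λ e → cutSize (G e) X) ∎
  where open ≡-Reasoning

cutSize-*ʳ : ∀ {n} (G : MultiGraph n) c X → cutSize (λ u v → G u v * c) X ≡ cutSize G X * c
cutSize-*ʳ G c X = begin
  cutSize (λ u v → G u v * c) X
    ≡⟨ cutSize≡sum (λ u v → G u v * c) X ⟩
  sum (λ u → sum (λ v → separates X u v * (G u v * c)))
    ≡⟨ sum-cong-≗ (λ u → sum-cong-≗ (λ v → *-assoc (separates X u v) (G u v) c)) ⟨
  sum (λ u → sum (λ v → separates X u v * G u v * c))
    ≡⟨ sum-cong-≗ (λ u → *-distribʳ-sum c (λ v → separates X u v * G u v)) ⟨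
  sum (λ u → sum (λ v → separates X u v * G u v) * c)
    ≡⟨ *-distribʳ-sum c (λ u → sum (λ v → separates X u v * G u v)) ⟨
  sum (λ u → sum (λ v → separates X u v * G u v)) * c
    ≡⟨ cong (_* c) (cutSize≡sum G X) ⟨
  cutSize G X * c ∎
  where open ≡-Reasoning

-- The Petersen graph

end₁ end₂ : Fin 15 → Fin 10
end₁ e = proj₁ (lookup PetersenEdges e)
end₂ e = proj₂ (lookup PetersenEdges e)

crosses : Subset 10 → Fin 15 → Bool
crosses X e = lookup X (end₁ e) xor lookup X (end₂ e)

-- Facts about P checked by evaluating a decision procedure are opaque, so that a later
-- with-abstraction never unfolds them and re-runs the search.
opaque
  joins-indicator : ∀ e u v →
    [ joins e u v ] ≡ [ ⌊ end₁ e ≟ u ⌋ ∧ ⌊ end₂ e ≟ v ⌋ ] + [ ⌊ end₂ e ≟ u ⌋ ∧ ⌊ end₁ e ≟ v ⌋ ]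
  joins-indicator = from-yes (all? λ e → all? λ u → all? λ v →
    [ joins e u v ] ℕ.≟ [ ⌊ end₁ e ≟ u ⌋ ∧ ⌊ end₂ e ≟ v ⌋ ] + [ ⌊ end₂ e ≟ u ⌋ ∧ ⌊ end₁ e ≟ v ⌋ ])

cutSize-joins : ∀ e X → cutSize (λ u v → [ joins e u v ]) X ≡ [ crosses X e ]
cutSize-joins e X = begin
  cutSize (λ u v → [ joins e u v ]) X
    ≡⟨ cutSize≡sum (λ u v → [ joins e u v ]) X ⟩
  sum (λ u → sum (λ v → sep u v * [ joins e u v ]))
    ≡⟨ sum-cong-≗ (λ u → sum-cong-≗ (λ v → split u v)) ⟩
  sum (λ u → sum (λ v → forward u v * sep u v + backward u v * sep u v))
    ≡⟨ sum-cong-≗ (λ u → ∑-distrib-+ (λ v → forward u v * sep u v) (λ v → backward u v * sep u v)) ⟩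
  sum (λ u → sum (λ v → forward u v * sep u v) + sum (λ v → backward u v * sep u v))
    ≡⟨ ∑-distrib-+ (λ u → sum (λ v → forward u v * sep u v)) (λ u → sum (λ v → backward u v * sep u v)) ⟩
  sum (λ u → sum (λ v → forward u v * sep u v)) + sum (λ u → sum (λ v → backward u v * sep u v))
    ≡⟨ cong₂ _+_ (sum-δ₂ (end₁ e) (end₂ e) sep) (sum-δ₂ (end₂ e) (end₁ e) sep) ⟩
  sep (end₁ e) (end₂ e) + sep (end₂ e) (end₁ e)
    ≡⟨ [∧not]+[∧not]≡[xor] (lookup X (end₁ e)) (lookup X (end₂ e)) ⟩
  [ crosses X e ] ∎
  where
  open ≡-Reasoning
  sep forward backward : Fin 10 → Fin 10 → ℕ
  sep          = separates X
  forward  u v = [ ⌊ end₁ e ≟ u ⌋ ∧ ⌊ end₂ e ≟ v ⌋ ]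
  backward u v = [ ⌊ end₂ e ≟ u ⌋ ∧ ⌊ end₁ e ≟ v ⌋ ]
  split : ∀ u v → sep u v * [ joins e u v ] ≡ forward u v * sep u v + backward u v * sep u v
  split u v = begin
    sep u v * [ joins e u v ]                    ≡⟨ cong (sep u v *_) (joins-indicator e u v) ⟩
    sep u v * (forward u v + backward u v)       ≡⟨ *-distribˡ-+ (sep u v) (forward u v) (backward u v) ⟩
    sep u v * forward u v + sep u v * backward u v
      ≡⟨ cong₂ _+_ (*-comm (sep u v) (forward u v)) (*-comm (sep u v) (backward u v)) ⟩
    forward u v * sep u v + backward u v * sep u v ∎

weighted : (Fin 15 → ℕ) → MultiGraph 10
weighted w u v = sum (λ e → [ joins e u v ] * w e)

cutWeight : (Fin 15 → ℕ) → Subset 10 → ℕ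
cutWeight w X = sum (λ e → [ crosses X e ] * w e)

cutSize-weighted : ∀ w X → cutSize (weighted w) X ≡ cutWeight w X
cutSize-weighted w X = trans (cutSize-sum (λ e u v → [ joins e u v ] * w e) X)
  (sum-cong-≗ (λ e → trans (cutSize-*ʳ (λ u v → [ joins e u v ]) (w e) X) (cong (_* w e) (cutSize-joins e X))))

opaque
  joins-ends : ∀ e e′ → joins e′ (end₁ e) (end₂ e) ≡ ⌊ e ≟ e′ ⌋
  joins-ends = from-yes (all? λ e → all? λ e′ → joins e′ (end₁ e) (end₂ e) Bool.≟ ⌊ e ≟ e′ ⌋)

opaque
  joins-none-or-one : ∀ u v → (∀ e → joins e u v ≡ false) ⊎ ∃ λ e → ∀ e′ → joins e′ u v ≡ ⌊ e ≟ e′ ⌋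
  joins-none-or-one = from-yes (all? λ u → all? λ v →
    all? (λ e → joins e u v Bool.≟ false) ⊎-dec any? (λ e → all? λ e′ → joins e′ u v Bool.≟ ⌊ e ≟ e′ ⌋))

weighted-ends : ∀ w e → weighted w (end₁ e) (end₂ e) ≡ w e
weighted-ends w e = trans (sum-cong-≗ (λ e′ → cong (λ b → [ b ] * w e′) (joins-ends e e′))) (sum-δ e w)

weighted-zero-or-edge : ∀ w u v → weighted w u v ≡ 0 ⊎ ∃ λ e → weighted w u v ≡ w e
weighted-zero-or-edge w u v with joins-none-or-one u v
... | inj₁ none = inj₁ (trans (sum-cong-≗ (λ e → cong (λ b → [ b ] * w e) (none e))) (sum-replicate-zero 15))
... | inj₂ (e , one) =
  inj₂ (e , trans (sum-cong-≗ (λ e′ → cong (λ b → [ b ] * w e′) (one e′))) (sum-δ e w))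

-- Perfect matchings of P

crossing : (Fin 15 → Bool) → Subset 10 → ℕ
crossing F = cutWeight (λ e → [ F e ])

crossing-cong : ∀ {F G} → F ≗ G → ∀ X → crossing F X ≡ crossing G X
crossing-cong F≗G X = sum-cong-≗ (λ e → cong (λ b → [ crosses X e ] * [ b ]) (F≗G e))

allEdges : Fin 15 → Bool
allEdges _ = true

matching : Fin 6 → Subset 15
matching zero                            = true  ∷ false ∷ true  ∷ false ∷ false ∷ false ∷ false ∷ false ∷ false ∷ true  ∷ true  ∷ false ∷ false ∷ true  ∷ false ∷ []
matching (suc zero)                      = true  ∷ false ∷ false ∷ true  ∷ false ∷ false ∷ false ∷ true  ∷ false ∷ false ∷ false ∷ false ∷ true  ∷ false ∷ true  ∷ []
matching (suc (suc zero))                = false ∷ true  ∷ false ∷ true  ∷ false ∷ true  ∷ false ∷ false ∷ false ∷ false ∷ false ∷ true  ∷ false ∷ true  ∷ false ∷ []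
matching (suc (suc (suc zero)))          = false ∷ true  ∷ false ∷ false ∷ true  ∷ false ∷ false ∷ false ∷ true  ∷ false ∷ true  ∷ false ∷ true  ∷ false ∷ false ∷ []
matching (suc (suc (suc (suc zero))))    = false ∷ false ∷ true  ∷ false ∷ true  ∷ false ∷ true  ∷ false ∷ false ∷ false ∷ false ∷ true  ∷ false ∷ false ∷ true  ∷ []
matching (suc (suc (suc (suc (suc zero))))) = false ∷ false ∷ false ∷ false ∷ false ∷ true  ∷ true  ∷ true  ∷ true  ∷ true  ∷ false ∷ false ∷ false ∷ false ∷ false ∷ []

opaque
  isPerfectMatching⇒matching : ∀ F → IsPerfectMatching (lookup F) → ∃ λ l → F ≡ matching l
  isPerfectMatching⇒matching = ∀-Subset (λ F →
    all? (λ v → Σ[ 15 ] (λ e → [ lookup F e ∧ incident e v ]) ℕ.≟ 1)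
    →-dec any? (λ l → ≡-dec Bool._≟_ F (matching l))) _

isPerfectMatching-resp : ∀ {F G} → F ≗ G → IsPerfectMatching F → IsPerfectMatching G
isPerfectMatching-resp {F} {G} F≗G perfectF v = begin
  Σ[ 15 ] (λ e → [ G e ∧ incident e v ])  ≡⟨ Σ≡sum 15 (λ e → [ G e ∧ incident e v ]) ⟩
  sum (λ e → [ G e ∧ incident e v ])      ≡⟨ sum-cong-≗ (λ e → cong (λ b → [ b ∧ incident e v ]) (F≗G e)) ⟨
  sum (λ e → [ F e ∧ incident e v ])      ≡⟨ Σ≡sum 15 (λ e → [ F e ∧ incident e v ]) ⟨
  Σ[ 15 ] (λ e → [ F e ∧ incident e v ])  ≡⟨ perfectF v ⟩
  1 ∎
  where open ≡-Reasoning

perfectMatching⇒matching : (F : PerfectMatching) → ∃ λ l → edges F ≗ lookup (matching l)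
perfectMatching⇒matching F =
  map₂ (λ F≡l e → trans (tabulated e) (cong (λ S → lookup S e) F≡l))
       (isPerfectMatching⇒matching (tabulate (edges F)) (isPerfectMatching-resp tabulated (perfect F)))
  where
  tabulated : edges F ≗ lookup (tabulate (edges F))
  tabulated e = sym (lookup∘tabulate (edges F) e)

perfectMatching-cases : ∀ {p} (Q : (Fin 15 → Bool) → Set p) → (∀ {F G} → F ≗ G → Q G → Q F) →
  (∀ l → Q (lookup (matching l))) → (F : PerfectMatching) → Q (edges F)
perfectMatching-cases Q resp Q-matching F with perfectMatching⇒matching F
... | l , F≗l = resp F≗l (Q-matching l)

opaque
  crossing-matchings : ∀ X → NonEmptyProper X →
      (3 ≤ crossing allEdges X × ∀ l → 1 ≤ crossing (lookup (matching l)) X)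
    ⊎ ∃ λ e → 4 ≤ crossing allEdges X × ∀ l → 2 ≤ crossing (lookup (matching l)) X + 2 * [ lookup (matching l) e ]
  crossing-matchings = ∀-Subset (λ X → nonEmptyProper? X →-dec
    (  ((3 ≤? crossing allEdges X) ×-dec all? (λ l → 1 ≤? crossing (lookup (matching l)) X))
    ⊎-dec any? (λ e → (4 ≤? crossing allEdges X) ×-dec
                      all? (λ l → 2 ≤? crossing (lookup (matching l)) X + 2 * [ lookup (matching l) e ])))) _

crossing-perfectMatchings : ∀ X → NonEmptyProper X →
    (3 ≤ crossing allEdges X × ∀ (F : PerfectMatching) → 1 ≤ crossing (edges F) X)
  ⊎ ∃ λ e → 4 ≤ crossing allEdges X × ∀ (F : PerfectMatching) → 2 ≤ crossing (edges F) X + 2 * [ edges F e ]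
crossing-perfectMatchings X nep with crossing-matchings X nep
... | inj₁ (three , one) = inj₁ (three , perfectMatching-cases (λ F → 1 ≤ crossing F X)
        (λ F≗G → subst (1 ≤_) (sym (crossing-cong F≗G X))) one)
... | inj₂ (e , four , two) = inj₂ (e , four , perfectMatching-cases (λ F → 2 ≤ crossing F X + 2 * [ F e ])
        (λ F≗G → subst (2 ≤_) (sym (cong₂ (λ c b → c + 2 * [ b ]) (crossing-cong F≗G X) (F≗G e)))) two)

opaque
  crosses-⁅⁆ : ∀ v e → crosses ⁅ v ⁆ e ≡ incident e v
  crosses-⁅⁆ = from-yes (all? λ v → all? λ e → crosses ⁅ v ⁆ e Bool.≟ incident e v)

opaque
  crossing-allEdges-⁅⁆ : ∀ v → crossing allEdges ⁅ v ⁆ ≡ 3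
  crossing-allEdges-⁅⁆ = from-yes (all? λ v → crossing allEdges ⁅ v ⁆ ℕ.≟ 3)

crossing-perfectMatching-⁅⁆ : ∀ (F : PerfectMatching) v → crossing (edges F) ⁅ v ⁆ ≡ 1
crossing-perfectMatching-⁅⁆ F v = begin
  sum (λ e → [ crosses ⁅ v ⁆ e ] * [ edges F e ])
    ≡⟨ sum-cong-≗ (λ e → cong (λ b → [ b ] * [ edges F e ]) (crosses-⁅⁆ v e)) ⟩
  sum (λ e → [ incident e v ] * [ edges F e ])
    ≡⟨ sum-cong-≗ (λ e → []*[]≡[∧] (incident e v) (edges F e)) ⟩
  sum (λ e → [ edges F e ∧ incident e v ])
    ≡⟨ Σ≡sum 15 (λ e → [ edges F e ∧ incident e v ]) ⟨
  Σ[ 15 ] (λ e → [ edges F e ∧ incident e v ])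
    ≡⟨ perfect F v ⟩
  1 ∎
  where open ≡-Reasoning

opaque
  ⁅⁆-nonEmptyProper : ∀ v → NonEmptyProper {10} ⁅ v ⁆
  ⁅⁆-nonEmptyProper = from-yes (all? λ (v : Fin 10) → nonEmptyProper? ⁅ v ⁆)

ends : Fin 15 → Subset 10
ends e = ⁅ end₁ e ⁆ ∪ ⁅ end₂ e ⁆

opaque
  ends-nonEmptyProper : ∀ e → NonEmptyProper (ends e)
  ends-nonEmptyProper = from-yes (all? λ e → nonEmptyProper? (ends e))

opaque
  crossing-allEdges-ends : ∀ e → crossing allEdges (ends e) ≡ 4
  crossing-allEdges-ends = from-yes (all? λ e → crossing allEdges (ends e) ℕ.≟ 4)

opaque
  crossing-matching-ends : ∀ e l → crossing (lookup (matching l)) (ends e) + 2 * [ lookup (matching l) e ] ≡ 2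
  crossing-matching-ends = from-yes (all? λ e → all? λ l →
    crossing (lookup (matching l)) (ends e) + 2 * [ lookup (matching l) e ] ℕ.≟ 2)

crossing-perfectMatching-ends : ∀ (F : PerfectMatching) e → crossing (edges F) (ends e) + 2 * [ edges F e ] ≡ 2
crossing-perfectMatching-ends F e = perfectMatching-cases (λ F → crossing F (ends e) + 2 * [ F e ] ≡ 2)
  (λ F≗G → trans (cong₂ (λ c b → c + 2 * [ b ]) (crossing-cong F≗G (ends e)) (F≗G e)))
  (crossing-matching-ends e) F

-- The graph P^M

module _ {k} (M : Fin k → PerfectMatching) where

  multiplicity : Fin 15 → ℕ
  multiplicity e = 1 + sum (λ i → [ edges (M i) e ])

  P^≡weighted : ∀ u v → P^ M u v ≡ weighted multiplicity u v
  P^≡weighted u v = trans (Σ≡sum 15 (λ e → [ joins e u v ] * (1 + Σ[ k ] (λ i → [ edges (M i) e ]))))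
    (sum-cong-≗ (λ e → cong (λ s → [ joins e u v ] * (1 + s)) (Σ≡sum k (λ i → [ edges (M i) e ]))))

  P^-ends : ∀ e → P^ M (end₁ e) (end₂ e) ≡ multiplicity e
  P^-ends e = trans (P^≡weighted (end₁ e) (end₂ e)) (weighted-ends multiplicity e)

  P^-zero-or-edge : ∀ u v → P^ M u v ≡ 0 ⊎ ∃ λ e → P^ M u v ≡ multiplicity e
  P^-zero-or-edge u v with weighted-zero-or-edge multiplicity u v
  ... | inj₁ uv≡0         = inj₁ (trans (P^≡weighted u v) uv≡0)
  ... | inj₂ (e , uv≡e) = inj₂ (e , trans (P^≡weighted u v) uv≡e)

  cutSize-P^ : ∀ X → cutSize (P^ M) X ≡ crossing allEdges X + sum (λ i → crossing (edges (M i)) X)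
  cutSize-P^ X = begin
    cutSize (P^ M) X
      ≡⟨ cutSize-cong P^≡weighted X ⟩
    cutSize (weighted multiplicity) X
      ≡⟨ cutSize-weighted multiplicity X ⟩
    sum (λ e → [ crosses X e ] * (1 + sum (λ i → [ edges (M i) e ])))
      ≡⟨ sum-cong-≗ (λ e → trans (*-distribˡ-+ [ crosses X e ] 1 _)
                                 (cong ([ crosses X e ] * 1 +_) (*-distribˡ-sum [ crosses X e ] (λ i → [ edges (M i) e ])))) ⟩
    sum (λ e → [ crosses X e ] * 1 + sum (λ i → [ crosses X e ] * [ edges (M i) e ]))
      ≡⟨ ∑-distrib-+ (λ e → [ crosses X e ] * 1) (λ e → sum (λ i → [ crosses X e ] * [ edges (M i) e ])) ⟩
    crossing allEdges X + sum (λ e → sum (λ i → [ crosses X e ] * [ edges (M i) e ]))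
      ≡⟨ cong (crossing allEdges X +_) (∑-comm (λ e i → [ crosses X e ] * [ edges (M i) e ])) ⟩
    crossing allEdges X + sum (λ i → crossing (edges (M i)) X) ∎
    where open ≡-Reasoning

  cutSize-P^+2*multiplicity : ∀ X e → cutSize (P^ M) X + 2 * multiplicity e
    ≡ (crossing allEdges X + 2) + sum (λ i → crossing (edges (M i)) X + 2 * [ edges (M i) e ])
  cutSize-P^+2*multiplicity X e = begin
    cutSize (P^ M) X + 2 * multiplicity e
      ≡⟨ cong (_+ 2 * multiplicity e) (cutSize-P^ X) ⟩
    crossing allEdges X + sum crossingᵢ + 2 * (1 + sum inᵢ)
      ≡⟨ solve 3 (λ a c m → a :+ c :+ con 2 :* (con 1 :+ m) := (a :+ con 2) :+ (c :+ con 2 :* m))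
               refl (crossing allEdges X) (sum crossingᵢ) (sum inᵢ) ⟩
    (crossing allEdges X + 2) + (sum crossingᵢ + 2 * sum inᵢ)
      ≡⟨ cong (λ s → crossing allEdges X + 2 + (sum crossingᵢ + s)) (*-distribˡ-sum 2 inᵢ) ⟩
    (crossing allEdges X + 2) + (sum crossingᵢ + sum (λ i → 2 * inᵢ i))
      ≡⟨ cong (crossing allEdges X + 2 +_) (∑-distrib-+ crossingᵢ (λ i → 2 * inᵢ i)) ⟨
    (crossing allEdges X + 2) + sum (λ i → crossing (edges (M i)) X + 2 * [ edges (M i) e ]) ∎
    where
    open ≡-Reasoning
    crossingᵢ inᵢ : Fin k → ℕ
    crossingᵢ i = crossing (edges (M i)) X
    inᵢ i = [ edges (M i) e ]

  6+k*2≡2*k+6 : 6 + k * 2 ≡ 2 * k + 6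
  6+k*2≡2*k+6 = trans (+-comm 6 (k * 2)) (cong (_+ 6) (*-comm k 2))

  k+3≤cutSize : ∀ X → 3 ≤ crossing allEdges X → (∀ F → 1 ≤ crossing (edges F) X) → k + 3 ≤ cutSize (P^ M) X
  k+3≤cutSize X three one = begin
    k + 3                                                       ≡⟨ +-comm k 3 ⟩
    3 + k                                                       ≡⟨ cong (3 +_) (trans (sum-const k 1) (*-identityʳ k)) ⟨
    3 + sum {k} (λ _ → 1)                                       ≤⟨ +-mono-≤ three (sum-mono-≤ (λ i → one (M i))) ⟩
    crossing allEdges X + sum (λ i → crossing (edges (M i)) X)  ≡⟨ cutSize-P^ X ⟨
    cutSize (P^ M) X                                            ∎
    where open ≤-Reasoning

  2*k+6∸2*μ≤cutSize : ∀ {μ} X e → multiplicity e ≤ μ → 4 ≤ crossing allEdges X →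
    (∀ F → 2 ≤ crossing (edges F) X + 2 * [ edges F e ]) → 2 * k + 6 ∸ 2 * μ ≤ cutSize (P^ M) X
  2*k+6∸2*μ≤cutSize {μ} X e e≤μ four two = m≤n+o⇒m∸n≤o (2 * k + 6) (2 * μ) (begin
    2 * k + 6                    ≡⟨ 6+k*2≡2*k+6 ⟨
    6 + k * 2                    ≡⟨ cong (6 +_) (sum-const k 2) ⟨
    (4 + 2) + sum {k} (λ _ → 2)  ≤⟨ +-mono-≤ (+-mono-≤ four ≤-refl) (sum-mono-≤ (λ i → two (M i))) ⟩
    (crossing allEdges X + 2) + sum (λ i → crossing (edges (M i)) X + 2 * [ edges (M i) e ])
                                 ≡⟨ cutSize-P^+2*multiplicity X e ⟨
    cutSize (P^ M) X + 2 * multiplicity e  ≤⟨ +-monoʳ-≤ (cutSize (P^ M) X) (*-monoʳ-≤ 2 e≤μ) ⟩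
    cutSize (P^ M) X + 2 * μ               ≡⟨ +-comm (cutSize (P^ M) X) (2 * μ) ⟩
    2 * μ + cutSize (P^ M) X               ∎)
    where open ≤-Reasoning

  cutSize-⁅⁆ : ∀ v → cutSize (P^ M) ⁅ v ⁆ ≡ k + 3
  cutSize-⁅⁆ v = begin
    cutSize (P^ M) ⁅ v ⁆
      ≡⟨ cutSize-P^ ⁅ v ⁆ ⟩
    crossing allEdges ⁅ v ⁆ + sum (λ i → crossing (edges (M i)) ⁅ v ⁆)
      ≡⟨ cong₂ _+_ (crossing-allEdges-⁅⁆ v) (sum-cong-≗ (λ i → crossing-perfectMatching-⁅⁆ (M i) v)) ⟩
    3 + sum {k} (λ _ → 1)
      ≡⟨ cong (3 +_) (trans (sum-const k 1) (*-identityʳ k)) ⟩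
    3 + k
      ≡⟨ +-comm 3 k ⟩
    k + 3 ∎
    where open ≡-Reasoning

  cutSize-ends+2*multiplicity : ∀ e → cutSize (P^ M) (ends e) + 2 * multiplicity e ≡ 2 * k + 6
  cutSize-ends+2*multiplicity e = begin
    cutSize (P^ M) (ends e) + 2 * multiplicity e
      ≡⟨ cutSize-P^+2*multiplicity (ends e) e ⟩
    (crossing allEdges (ends e) + 2) + sum (λ i → crossing (edges (M i)) (ends e) + 2 * [ edges (M i) e ])
      ≡⟨ cong₂ _+_ (cong (_+ 2) (crossing-allEdges-ends e)) (sum-cong-≗ (λ i → crossing-perfectMatching-ends (M i) e)) ⟩
    6 + sum {k} (λ _ → 2)
      ≡⟨ cong (6 +_) (sum-const k 2) ⟩
    6 + k * 2
      ≡⟨ 6+k*2≡2*k+6 ⟩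
    2 * k + 6 ∎
    where open ≡-Reasoning

  cutSize-ends : ∀ e → cutSize (P^ M) (ends e) ≡ 2 * k + 6 ∸ 2 * multiplicity e
  cutSize-ends e = trans (sym (m+n∸n≡m (cutSize (P^ M) (ends e)) (2 * multiplicity e)))
                         (cong (_∸ 2 * multiplicity e) (cutSize-ends+2*multiplicity e))

k+3≤2*k+6 : ∀ k → k + 3 ≤ 2 * k + 6
k+3≤2*k+6 k = +-mono-≤ (m≤m+n k (k + 0)) (m≤m+n 3 3)

lemma2p3 : (k : ℕ) (M : Fin k → PerfectMatching) (μ : ℕ) →
    IsMaxMultiplicity (P^ M) μ →
    IsEdgeConnectivity (P^ M) ((k + 3) ⊓ ((2 * k + 6) ∸ 2 * μ))
lemma2p3 k M μ ((u , v , uv≡μ) , ≤μ) = lower , upper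
  where
  lower : ∀ X → NonEmptyProper X → (k + 3) ⊓ (2 * k + 6 ∸ 2 * μ) ≤ cutSize (P^ M) X
  lower X nep with crossing-perfectMatchings X nep
  ... | inj₁ (three , one)    = ≤-trans (m⊓n≤m _ _) (k+3≤cutSize M X three one)
  ... | inj₂ (e , four , two) = ≤-trans (m⊓n≤n _ _)
          (2*k+6∸2*μ≤cutSize M X e (subst (_≤ μ) (P^-ends M e) (≤μ (end₁ e) (end₂ e))) four two)

  upper : ∀ c → (∀ X → NonEmptyProper X → c ≤ cutSize (P^ M) X) → c ≤ (k + 3) ⊓ (2 * k + 6 ∸ 2 * μ)
  upper c c≤cut = ⊓-glb c≤k+3 c≤2k+6∸2μ
    where
    c≤k+3 : c ≤ k + 3
    c≤k+3 = subst (c ≤_) (cutSize-⁅⁆ M zero) (c≤cut ⁅ zero ⁆ (⁅⁆-nonEmptyProper zero))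
    c≤2k+6∸2μ : c ≤ 2 * k + 6 ∸ 2 * μ
    c≤2k+6∸2μ with P^-zero-or-edge M u v
    ... | inj₁ uv≡0       = subst (λ m → c ≤ 2 * k + 6 ∸ 2 * m) (trans (sym uv≡0) uv≡μ)
                              (≤-trans c≤k+3 (k+3≤2*k+6 k))
    ... | inj₂ (e , uv≡e) = subst (λ m → c ≤ 2 * k + 6 ∸ 2 * m) (trans (sym uv≡e) uv≡μ)
                              (subst (c ≤_) (cutSize-ends M e) (c≤cut (ends e) (ends-nonEmptyProper e)))
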